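{- Let $g:\{0,1\}^n\to\{0,1\}$ be symmetric, let $t>0$ be the minimal Hamming weight of an input $z$ with $g(z)=1$, and let $f(x,y)=g(x\wedge y)$. Then $D^{1\,round}(f)=\left\lceil\log_2\left(\sum_{i=t}^n\binom{n}{i}+1\right)\right\rceil+1$.
   Context: $g$ is symmetric if $g(z)$ depends only on the Hamming weight $|z|$. $x\wedge y$ is the bitwise AND. $D^{1\,round}(f)$ is the deterministic classical communication complexity of $f$ restricted to 1-round protocols: Alice (holding $x$) sends a single message to Bob (holding $y$), and Bob then sends the output bit $f(x,y)$; the cost is the worst-case total number of bits sent. -}

module Defs where

open import Data.Bool using (Bool; true; false; _∧_)
open import Data.Nat using (ℕ; zero; suc; _+_; _∸_; _≤_)
open import Data.Nat.Combinatorics using (_C_)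
open import Data.List using (List; length; _++_; map; upTo)
open import Data.Nat.ListAction using (sum)
open import Data.Vec using (Vec; zipWith; countᵇ)
open import Data.Product using (∃)
open import Relation.Binary.PropositionalEquality using (_≡_)
open import Function using (id)

weight : ∀ {n} → Vec Bool n → ℕ
weight = countᵇ id

_⋀_ : ∀ {n} → Vec Bool n → Vec Bool n → Vec Bool n
x ⋀ y = zipWith _∧_ x y

Symmetric : ∀ {n} → (Vec Bool n → Bool) → Set
Symmetric g = ∀ z z' → weight z ≡ weight z' → g z ≡ g z'

IsMinOneWeight : ∀ {n} → (Vec Bool n → Bool) → ℕ → Set
IsMinOneWeight g t =
  (∃ λ z → g z ≡ true × weight z ≡ t) × (∀ z → g z ≡ true → t ≤ weight z)
  where open import Data.Product using (_×_)

-- Σ_{i=t}^{n} (n choose i)  (empty sum if t > n).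
binomTail : ℕ → ℕ → ℕ
binomTail n t = sum (map (λ k → n C (t + k)) (upTo (suc n ∸ t)))

IsPrefix : List Bool → List Bool → Set
IsPrefix xs ys = ∃ λ zs → xs ++ zs ≡ ys

-- A deterministic 1-round protocol for f of cost at most c:
-- Alice sends a binary message msg x (the set of messages must be
-- prefix-free, so Bob knows where it ends), then Bob sends the output bit.
record OneRoundProtocol {X Y : Set} (f : X → Y → Bool) (c : ℕ) : Set where
  field
    msg         : X → List Bool
    bob         : List Bool → Y → Bool
    prefixFree  : ∀ x x' → IsPrefix (msg x) (msg x') → msg x ≡ msg x'
    costBound   : ∀ x → length (msg x) + 1 ≤ c
    correct     : ∀ x y → bob (msg x) y ≡ f x y

D1round≡ : {X Y : Set} → (X → Y → Bool) → ℕ → Set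
D1round≡ f d = OneRoundProtocol f d × (∀ c → OneRoundProtocol f c → d ≤ c)
  where open import Data.Product using (_×_)

module Submission where

-- An input x of weight < t gives the all-zero row of the matrix (g (x ⋀ y))ₓ,ᵧ,
-- while heavier inputs give pairwise different nonzero rows: if x has a 1 at a position i where
-- x' has a 0, a y ⊆ x of weight t containing i gives |x ⋀ y| = t but |x' ⋀ y| < t. So the
-- matrix has exactly binomTail n t + 1 distinct rows. In a one-round protocol Alice's message
-- must determine Bob's row; as prefix-free words of length ≤ m are at most 2 ^ m, this costs
-- ⌈log₂ R⌉ + 1 bits for R rows, and sending the row class in binary achieves it.

open import Defs
open import Data.Bool using (Bool; true; false)
open import Data.Bool.Properties using () renaming (_≟_ to _≟ᵇ_)
open import Data.Nat
open import Data.Nat.Properties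
open import Data.Nat.Combinatorics using (_C_; k>n⇒nCk≡0; nCk+nC[k+1]≡[n+1]C[k+1])
open import Data.Nat.ListAction using (sum)
open import Data.Nat.Logarithm using (⌈log₂_⌉; ⌈log₂⌉-mono-≤; ⌈log₂2^n⌉≡n)
open import Data.Nat.Logarithm.Core using (⌈log2⌉)
open import Algebra.Properties.CommutativeSemigroup +-commutativeSemigroup using (interchange)
open import Data.Fin as Fin
  using (Fin; zero; suc; inject≤; combine; quotient; remainder; _↑ˡ_; _↑ʳ_)
open import Data.Fin.Properties
  using (2↔Bool; combine-remQuot; remQuot-combine; injective⇒≤; inject≤-injective; any?;
         splitAt-↑ˡ; splitAt-↑ʳ; splitAt⁻¹-↑ˡ; splitAt⁻¹-↑ʳ)
open import Data.Fin.Subset using (∣_∣)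
open import Data.Fin.Subset.Properties using (∣p∩q∣≤∣p∣; ∣p∩q∣≤∣q∣)
open import Data.List as List using (List; []; _∷_; length; _++_)
open import Data.List.Properties as Listₚ using (≡-dec)
open import Data.Vec as Vec using (Vec; []; _∷_; toList)
open import Data.Vec.Properties as Vecₚ using (length-toList)
open import Data.Product using (∃; _×_; _,_; proj₁; proj₂)
open import Data.Sum using (_⊎_; inj₁; inj₂)
open import Function using (Injective; Inverse; _∘_)
open import Induction.WellFounded using (Acc; acc)
open import Relation.Nullary using (¬_; yes; no; contradiction)
open import Relation.Binary.PropositionalEquality

open Inverse 2↔Bool using () renaming (to to bit; from to unbit)

toBits : ∀ L → Fin (2 ^ L) → Vec Bool L
toBits zero    _ = []
toBits (suc L) i = bit (quotient {2} (2 ^ L) i) ∷ toBits L (remainder {2} (2 ^ L) i)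

fromBits : ∀ {L} → Vec Bool L → Fin (2 ^ L)
fromBits []      = zero
fromBits (b ∷ v) = combine (unbit b) (fromBits v)

fromBits-toBits : ∀ L (i : Fin (2 ^ L)) → fromBits (toBits L i) ≡ i
fromBits-toBits zero    zero = refl
fromBits-toBits (suc L) i = begin
  combine (unbit (bit q)) (fromBits (toBits L r))
    ≡⟨ cong₂ combine (Inverse.strictlyInverseʳ 2↔Bool q) (fromBits-toBits L r) ⟩
  combine q r
    ≡⟨ combine-remQuot {2} (2 ^ L) i ⟩
  i ∎
  where open ≡-Reasoning
        q = quotient {2} (2 ^ L) i
        r = remainder {2} (2 ^ L) i

toBits-fromBits : ∀ {L} (v : Vec Bool L) → toBits L (fromBits v) ≡ v
toBits-fromBits []              = refl
toBits-fromBits {suc L} (b ∷ v) = begin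
  toBits (suc L) (combine (unbit b) (fromBits v))
    ≡⟨ cong (λ (q , r) → bit q ∷ toBits L r) (remQuot-combine {2} {2 ^ L} (unbit b) (fromBits v)) ⟩
  bit (unbit b) ∷ toBits L (fromBits v)
    ≡⟨ cong₂ _∷_ (Inverse.strictlyInverseˡ 2↔Bool b) (toBits-fromBits v) ⟩
  b ∷ v ∎
  where open ≡-Reasoning

fromBits-injective : ∀ {L} → Injective _≡_ _≡_ (fromBits {L})
fromBits-injective {x = u} {v} e =
  trans (sym (toBits-fromBits u)) (trans (cong (toBits _) e) (toBits-fromBits v))

n≤2*⌈n/2⌉ : ∀ n → n ≤ 2 * ⌈ n /2⌉
n≤2*⌈n/2⌉ n = begin
  n                   ≡⟨ ⌊n/2⌋+⌈n/2⌉≡n n ⟨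
  ⌊ n /2⌋ + ⌈ n /2⌉   ≤⟨ +-monoˡ-≤ ⌈ n /2⌉ (⌊n/2⌋≤⌈n/2⌉ n) ⟩
  ⌈ n /2⌉ + ⌈ n /2⌉   ≡⟨ cong (⌈ n /2⌉ +_) (+-identityʳ ⌈ n /2⌉) ⟨
  2 * ⌈ n /2⌉         ∎
  where open ≤-Reasoning

n≤2^⌈log2⌉n : ∀ n (rec : Acc _<_ n) → n ≤ 2 ^ ⌈log2⌉ n rec
n≤2^⌈log2⌉n 0             _        = z≤n
n≤2^⌈log2⌉n 1             _        = ≤-refl
n≤2^⌈log2⌉n (suc (suc n)) (acc rs) = ≤-trans (n≤2*⌈n/2⌉ (suc (suc n)))
  (*-monoʳ-≤ 2 (n≤2^⌈log2⌉n (suc ⌈ n /2⌉) (rs (⌈n/2⌉<n n))))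

n≤2^⌈log₂n⌉ : ∀ n → n ≤ 2 ^ ⌈log₂ n ⌉
n≤2^⌈log₂n⌉ n = n≤2^⌈log2⌉n n _

⌈log₂⌉-least : ∀ {n m} → n ≤ 2 ^ m → ⌈log₂ n ⌉ ≤ m
⌈log₂⌉-least {n} {m} n≤2^m = subst (⌈log₂ n ⌉ ≤_) (⌈log₂2^n⌉≡n m) (⌈log₂⌉-mono-≤ n≤2^m)

pad : ∀ m → List Bool → Vec Bool m
pad zero    _       = []
pad (suc m) []      = false ∷ pad m []
pad (suc m) (b ∷ w) = b ∷ pad m w

pad-toList : ∀ {m} (v : Vec Bool m) → pad m (toList v) ≡ v
pad-toList []      = refl
pad-toList (b ∷ v) = cong (b ∷_) (pad-toList v)

pad-≡⇒IsPrefix : ∀ m (u v : List Bool) → length u ≤ length v → length v ≤ m →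
                 pad m u ≡ pad m v → IsPrefix u v
pad-≡⇒IsPrefix m       []      v       _         _         _ = v , refl
pad-≡⇒IsPrefix zero    (_ ∷ _) (_ ∷ _) _         ()        _
pad-≡⇒IsPrefix (suc m) (a ∷ u) (b ∷ v) (s≤s u≤v) (s≤s v≤m) e
  with refl ← Vecₚ.∷-injectiveˡ e
  with zs , refl ← pad-≡⇒IsPrefix m u v u≤v v≤m (Vecₚ.∷-injectiveʳ e)
  = zs , refl

IsPrefix-sameLength⇒≡ : ∀ (u v : List Bool) → IsPrefix u v → length u ≡ length v → u ≡ v
IsPrefix-sameLength⇒≡ []      []      _         _ = refl
IsPrefix-sameLength⇒≡ (a ∷ u) (_ ∷ _) (zs , refl) l =
  cong (a ∷_) (IsPrefix-sameLength⇒≡ u (u ++ zs) (zs , refl) (suc-injective l))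

prefixFree⇒≤2^ : ∀ {R} m (w : Fin R → List Bool) → (∀ i → length (w i) ≤ m) →
                 (∀ i j → IsPrefix (w i) (w j) → i ≡ j) → R ≤ 2 ^ m
prefixFree⇒≤2^ m w short prefixFree = injective⇒≤ (padded-injective ∘ fromBits-injective)
  where
  padded-injective : ∀ {i j} → pad m (w i) ≡ pad m (w j) → i ≡ j
  padded-injective {i} {j} e with ≤-total (length (w i)) (length (w j))
  ... | inj₁ i≤j = prefixFree i j (pad-≡⇒IsPrefix m (w i) (w j) i≤j (short j) e)
  ... | inj₂ j≤i = sym (prefixFree j i (pad-≡⇒IsPrefix m (w j) (w i) j≤i (short i) (sym e)))

SameRow : {X Y : Set} → (X → Y → Bool) → X → X → Set
SameRow f x x' = ∀ y → f x y ≡ f x' y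

separatingColumn : {X Y : Set} {f : X → Y → Bool} {x x' : X} {y : Y} →
                   f x y ≡ true → f x' y ≡ false → ¬ SameRow f x x'
separatingColumn fxy≡true fx'y≡false same with () ← trans (sym fxy≡true) (trans (same _) fx'y≡false)

record RowClasses {X Y : Set} (f : X → Y → Bool) (R : ℕ) : Set where
  field
    class         : X → Fin R
    rep           : Fin R → X
    rep-class     : ∀ x → SameRow f (rep (class x)) x
    rep-injective : ∀ i j → SameRow f (rep i) (rep j) → i ≡ j

module _ {X Y : Set} {f : X → Y → Bool} {R : ℕ} (classes : RowClasses f R) where
  open RowClasses classes

  private
    L : ℕ
    L = ⌈log₂ R ⌉

  codeWord : Fin R → Vec Bool L
  codeWord i = toBits L (inject≤ i (n≤2^⌈log₂n⌉ R))

  classCode : Fin R → List Bool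
  classCode = toList ∘ codeWord

  length-classCode : ∀ i → length (classCode i) ≡ L
  length-classCode i = length-toList (codeWord i)

  classCode-injective : ∀ {i j} → classCode i ≡ classCode j → i ≡ j
  classCode-injective {i} {j} e = inject≤-injective _ _ i j (begin
    inject≤ i _                   ≡⟨ fromBits-toBits L _ ⟨
    fromBits (codeWord i)         ≡⟨ cong fromBits (pad-toList (codeWord i)) ⟨
    fromBits (pad L (classCode i)) ≡⟨ cong (fromBits ∘ pad L) e ⟩
    fromBits (pad L (classCode j)) ≡⟨ cong fromBits (pad-toList (codeWord j)) ⟩
    fromBits (codeWord j)         ≡⟨ fromBits-toBits L _ ⟩
    inject≤ j _                   ∎)
    where open ≡-Reasoning

  readClass : List Bool → Y → Bool
  readClass m y with any? (λ i → ≡-dec _≟ᵇ_ (classCode i) m)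
  ... | yes (i , _) = f (rep i) y
  ... | no _        = false

  sendClass : OneRoundProtocol f (⌈log₂ R ⌉ + 1)
  sendClass = record
    { msg        = classCode ∘ class
    ; bob        = readClass
    ; prefixFree = λ x x' p → IsPrefix-sameLength⇒≡ _ _ p
                     (trans (length-classCode (class x)) (sym (length-classCode (class x'))))
    ; costBound  = λ x → ≤-reflexive (cong (_+ 1) (length-classCode (class x)))
    ; correct    = correct
    }
    where
    correct : ∀ x y → readClass (classCode (class x)) y ≡ f x y
    correct x y with any? (λ i → ≡-dec _≟ᵇ_ (classCode i) (classCode (class x)))
    ... | yes (i , e) = trans (cong (λ j → f (rep j) y) (classCode-injective e)) (rep-class x y)
    ... | no none     = contradiction (class x , refl) none

  -- The input x₀ is only used to see that c ≥ 1.
  oneRound-lower : X → ∀ c → OneRoundProtocol f c → ⌈log₂ R ⌉ + 1 ≤ c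
  oneRound-lower x₀ c P = begin
    L + 1         ≤⟨ +-monoˡ-≤ 1 (⌈log₂⌉-least R≤2^[c∸1]) ⟩
    c ∸ 1 + 1     ≡⟨ m∸n+n≡m (≤-trans (m≤n+m 1 _) (costBound x₀)) ⟩
    c             ∎
    where
    open OneRoundProtocol P
    open ≤-Reasoning
    rowsDiffer : ∀ i j → IsPrefix (msg (rep i)) (msg (rep j)) → i ≡ j
    rowsDiffer i j p = rep-injective i j λ y →
      trans (sym (correct (rep i) y))
        (trans (cong (λ m → bob m y) (prefixFree (rep i) (rep j) p)) (correct (rep j) y))
    R≤2^[c∸1] : R ≤ 2 ^ (c ∸ 1)
    R≤2^[c∸1] = prefixFree⇒≤2^ (c ∸ 1) (msg ∘ rep)
      (λ i → m+n≤o⇒m≤o∸n (length (msg (rep i))) (costBound (rep i))) rowsDiffer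

  D1round≡-rowClasses : X → D1round≡ f (⌈log₂ R ⌉ + 1)
  D1round≡-rowClasses x₀ = sendClass , oneRound-lower x₀

-- The number of vectors in Vec Bool n of weight at least k; a leading true lowers the
-- required weight of the tail to pred k.
#weight≥ : ℕ → ℕ → ℕ
#weight≥ zero    zero    = 1
#weight≥ zero    (suc k) = 0
#weight≥ (suc n) k       = #weight≥ n (pred k) + #weight≥ n k

binomWindow : ℕ → ℕ → ℕ → ℕ
binomWindow n k zero    = 0
binomWindow n k (suc m) = n C k + binomWindow n (suc k) m

binomWindow-beyond : ∀ n k m → n < k → binomWindow n k m ≡ 0
binomWindow-beyond n k zero    n<k = refl
binomWindow-beyond n k (suc m) n<k rewrite k>n⇒nCk≡0 n<k =
  binomWindow-beyond n (suc k) m (m<n⇒m<1+n n<k)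

binomWindow-pascal : ∀ n k m →
  binomWindow (suc n) (suc k) m ≡ binomWindow n k m + binomWindow n (suc k) m
binomWindow-pascal n k zero    = refl
binomWindow-pascal n k (suc m) = begin
  suc n C suc k + binomWindow (suc n) (suc (suc k)) m
    ≡⟨ cong₂ _+_ (nCk+nC[k+1]≡[n+1]C[k+1] n k) (sym (binomWindow-pascal n (suc k) m)) ⟨
  (n C k + n C suc k) + (binomWindow n (suc k) m + binomWindow n (suc (suc k)) m)
    ≡⟨ interchange (n C k) (n C suc k) _ _ ⟩
  (n C k + binomWindow n (suc k) m) + (n C suc k + binomWindow n (suc (suc k)) m) ∎
  where open ≡-Reasoning

#weight≥≡binomWindow : ∀ n k m → n < k + m → #weight≥ n k ≡ binomWindow n k m
#weight≥≡binomWindow zero    zero    (suc m) _ = cong suc (sym (binomWindow-beyond 0 1 m z<s))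
#weight≥≡binomWindow zero    (suc k) m       _ = sym (binomWindow-beyond 0 (suc k) m z<s)
#weight≥≡binomWindow (suc n) (suc k) m (s≤s n<k+m) = begin
  #weight≥ n k + #weight≥ n (suc k)
    ≡⟨ cong₂ _+_ (#weight≥≡binomWindow n k m n<k+m)
                 (#weight≥≡binomWindow n (suc k) m (m<n⇒m<1+n n<k+m)) ⟩
  binomWindow n k m + binomWindow n (suc k) m
    ≡⟨ binomWindow-pascal n k m ⟨
  binomWindow (suc n) (suc k) m ∎
  where open ≡-Reasoning
-- Pascal's rule has no k - 1 here, so the two copies of #weight≥ n 0 are read off
-- windows of different lengths m + 1 and m.
#weight≥≡binomWindow (suc n) zero    (suc m) (s≤s n<m) = begin
  #weight≥ n 0 + #weight≥ n 0
    ≡⟨ cong₂ _+_ (#weight≥≡binomWindow n 0 (suc m) (m<n⇒m<1+n n<m))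
                 (#weight≥≡binomWindow n 0 m n<m) ⟩
  suc (binomWindow n 1 m) + binomWindow n 0 m
    ≡⟨ cong suc (+-comm (binomWindow n 1 m) (binomWindow n 0 m)) ⟩
  suc (binomWindow n 0 m + binomWindow n 1 m)
    ≡⟨ cong suc (binomWindow-pascal n 0 m) ⟨
  binomWindow (suc n) 0 (suc m) ∎
  where open ≡-Reasoning

sum-applyUpTo-binom : ∀ n k m (h : ℕ → ℕ) → (∀ j → h j ≡ k + j) →
  sum (List.applyUpTo (λ j → n C h j) m) ≡ binomWindow n k m
sum-applyUpTo-binom n k zero    h h≗ = refl
sum-applyUpTo-binom n k (suc m) h h≗ = cong₂ _+_
  (cong (n C_) (trans (h≗ 0) (+-identityʳ k)))
  (sum-applyUpTo-binom n (suc k) m (h ∘ suc) (λ j → trans (h≗ (suc j)) (+-suc k j)))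

binomTail≡#weight≥ : ∀ n t → binomTail n t ≡ #weight≥ n t
binomTail≡#weight≥ n t = begin
  sum (List.map (λ j → n C (t + j)) (List.upTo (suc n ∸ t)))
    ≡⟨ cong sum (Listₚ.map-upTo (λ j → n C (t + j)) (suc n ∸ t)) ⟩
  sum (List.applyUpTo (λ j → n C (t + j)) (suc n ∸ t))
    ≡⟨ sum-applyUpTo-binom n t (suc n ∸ t) (t +_) (λ _ → refl) ⟩
  binomWindow n t (suc n ∸ t)
    ≡⟨ #weight≥≡binomWindow n t (suc n ∸ t) (m≤n+m∸n (suc n) t) ⟨
  #weight≥ n t ∎
  where open ≡-Reasoning

pred[m]≤n⇒m≤1+n : ∀ {m n} → pred m ≤ n → m ≤ suc n
pred[m]≤n⇒m≤1+n {zero}  _ = z≤n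
pred[m]≤n⇒m≤1+n {suc m} p = s≤s p

enumWeight≥ : ∀ n k → Fin (#weight≥ n k) → Vec Bool n
enumWeight≥ zero    zero    zero = []
enumWeight≥ (suc n) k       i with Fin.splitAt (#weight≥ n (pred k)) i
... | inj₁ i₁ = true  ∷ enumWeight≥ n (pred k) i₁
... | inj₂ i₂ = false ∷ enumWeight≥ n k i₂

enumWeight≥-weight : ∀ n k i → k ≤ weight (enumWeight≥ n k i)
enumWeight≥-weight zero    zero    zero = z≤n
enumWeight≥-weight (suc n) k       i with Fin.splitAt (#weight≥ n (pred k)) i
... | inj₁ i₁ = pred[m]≤n⇒m≤1+n (enumWeight≥-weight n (pred k) i₁)
... | inj₂ i₂ = enumWeight≥-weight n k i₂

indexWeight≥ : ∀ n k (v : Vec Bool n) → k ≤ weight v → Fin (#weight≥ n k)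
indexWeight≥ zero    zero []          _   = zero
indexWeight≥ (suc n) k    (true  ∷ v) k≤w =
  indexWeight≥ n (pred k) v (pred-mono-≤ k≤w) ↑ˡ #weight≥ n k
indexWeight≥ (suc n) k    (false ∷ v) k≤w = #weight≥ n (pred k) ↑ʳ indexWeight≥ n k v k≤w

enum-index : ∀ n k v k≤w → enumWeight≥ n k (indexWeight≥ n k v k≤w) ≡ v
enum-index zero    zero []          _ = refl
enum-index (suc n) k    (true  ∷ v) k≤w
  rewrite splitAt-↑ˡ (#weight≥ n (pred k)) (indexWeight≥ n (pred k) v (pred-mono-≤ k≤w)) (#weight≥ n k)
  = cong (true ∷_) (enum-index n (pred k) v (pred-mono-≤ k≤w))
enum-index (suc n) k    (false ∷ v) k≤w
  rewrite splitAt-↑ʳ (#weight≥ n (pred k)) (#weight≥ n k) (indexWeight≥ n k v k≤w)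
  = cong (false ∷_) (enum-index n k v k≤w)

index-enum : ∀ n k i k≤w → indexWeight≥ n k (enumWeight≥ n k i) k≤w ≡ i
index-enum zero    zero    zero _   = refl
index-enum (suc n) k       i    k≤w with Fin.splitAt (#weight≥ n (pred k)) i in eq
... | inj₁ i₁ = trans (cong (_↑ˡ #weight≥ n k) (index-enum n (pred k) i₁ _)) (splitAt⁻¹-↑ˡ eq)
... | inj₂ i₂ = trans (cong (#weight≥ n (pred k) ↑ʳ_) (index-enum n k i₂ k≤w)) (splitAt⁻¹-↑ʳ eq)

enumWeight≥-injective : ∀ n k {i j} → enumWeight≥ n k i ≡ enumWeight≥ n k j → i ≡ j
enumWeight≥-injective n k {i} {j} e = begin
  i                                                               ≡⟨ index-enum n k i _ ⟨
  indexWeight≥ n k (enumWeight≥ n k i) (enumWeight≥-weight n k i) ≡⟨ index-cong e _ _ ⟩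
  indexWeight≥ n k (enumWeight≥ n k j) (enumWeight≥-weight n k j) ≡⟨ index-enum n k j _ ⟩
  j                                                               ∎
  where
  open ≡-Reasoning
  index-cong : ∀ {v w} → v ≡ w → ∀ p q → indexWeight≥ n k v p ≡ indexWeight≥ n k w q
  index-cong refl p q = cong (indexWeight≥ n k _) (≤-irrelevant p q)

weight≡∣∣ : ∀ {n} (v : Vec Bool n) → weight v ≡ ∣ v ∣
weight≡∣∣ []          = refl
weight≡∣∣ (true  ∷ v) = cong suc (weight≡∣∣ v)
weight≡∣∣ (false ∷ v) = weight≡∣∣ v

weight-⋀-≤ˡ : ∀ {n} (x y : Vec Bool n) → weight (x ⋀ y) ≤ weight x
weight-⋀-≤ˡ x y = subst₂ _≤_ (sym (weight≡∣∣ (x ⋀ y))) (sym (weight≡∣∣ x)) (∣p∩q∣≤∣p∣ x y)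

weight-⋀-≤ʳ : ∀ {n} (x y : Vec Bool n) → weight (x ⋀ y) ≤ weight y
weight-⋀-≤ʳ x y = subst₂ _≤_ (sym (weight≡∣∣ (x ⋀ y))) (sym (weight≡∣∣ y)) (∣p∩q∣≤∣q∣ x y)

weight-∷⋀false∷ : ∀ {n} b (x y : Vec Bool n) → weight ((b ∷ x) ⋀ (false ∷ y)) ≡ weight (x ⋀ y)
weight-∷⋀false∷ true  x y = refl
weight-∷⋀false∷ false x y = refl

weight-∷⋀true∷ : ∀ {n} b (x y : Vec Bool n) → weight ((b ∷ x) ⋀ (true ∷ y)) ≤ suc (weight (x ⋀ y))
weight-∷⋀true∷ true  x y = ≤-refl
weight-∷⋀true∷ false x y = n≤1+n _

subOfWeight : ∀ {n} (x : Vec Bool n) k → k ≤ weight x →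
              ∃ λ y → weight y ≡ k × weight (x ⋀ y) ≡ k
subOfWeight []          zero    _         = [] , refl , refl
subOfWeight (true  ∷ x) zero    _         with y , wy , wxy ← subOfWeight x zero z≤n =
  false ∷ y , wy , wxy
subOfWeight (true  ∷ x) (suc k) (s≤s k≤w) with y , wy , wxy ← subOfWeight x k k≤w =
  true ∷ y , cong suc wy , cong suc wxy
subOfWeight (false ∷ x) k       k≤w       with y , wy , wxy ← subOfWeight x k k≤w =
  false ∷ y , wy , wxy

data _⊈_ : ∀ {n} → Vec Bool n → Vec Bool n → Set where
  here  : ∀ {n} {x x' : Vec Bool n} → (true ∷ x) ⊈ (false ∷ x')
  there : ∀ {n} {a a'} {x x' : Vec Bool n} → x ⊈ x' → (a ∷ x) ⊈ (a' ∷ x')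

≡⊎⊈⊎⊉ : ∀ {n} (x x' : Vec Bool n) → x ≡ x' ⊎ x ⊈ x' ⊎ x' ⊈ x
≡⊎⊈⊎⊉ []      []        = inj₁ refl
≡⊎⊈⊎⊉ (a ∷ x) (a' ∷ x') with ≡⊎⊈⊎⊉ x x'
... | inj₂ (inj₁ x⊈x') = inj₂ (inj₁ (there x⊈x'))
... | inj₂ (inj₂ x'⊈x) = inj₂ (inj₂ (there x'⊈x))
... | inj₁ refl with a | a'
...   | true  | true  = inj₁ refl
...   | false | false = inj₁ refl
...   | true  | false = inj₂ (inj₁ here)
...   | false | true  = inj₂ (inj₂ here)

⊈⇒0<weight : ∀ {n} {x x' : Vec Bool n} → x ⊈ x' → 0 < weight x
⊈⇒0<weight here                      = z<s
⊈⇒0<weight (there {a = true}  x⊈x') = z<s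
⊈⇒0<weight (there {a = false} x⊈x') = ⊈⇒0<weight x⊈x'

separate : ∀ {n} {x x' : Vec Bool n} → x ⊈ x' → ∀ k → 0 < k → k ≤ weight x →
           ∃ λ y → weight (x ⋀ y) ≡ k × weight (x' ⋀ y) < k
separate {x = true ∷ x} {false ∷ x'} here (suc k) _ (s≤s k≤w)
  with y , wy , wxy ← subOfWeight x k k≤w
  = true ∷ y , cong suc wxy , s≤s (subst (weight (x' ⋀ y) ≤_) wy (weight-⋀-≤ʳ x' y))
separate (there {a = false} {a'} {x' = x'} x⊈x') k 0<k k≤w
  with y , wxy , wx'y ← separate x⊈x' k 0<k k≤w
  = false ∷ y , wxy , subst (_< k) (sym (weight-∷⋀false∷ a' x' y)) wx'y
separate (there {a = true} {a'} {x' = x'} x⊈x') 1 _ _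
  with y , wxy , wx'y ← separate x⊈x' 1 z<s (⊈⇒0<weight x⊈x')
  = false ∷ y , wxy , subst (_< 1) (sym (weight-∷⋀false∷ a' x' y)) wx'y
separate (there {a = true} {a'} {x' = x'} x⊈x') (suc (suc k)) _ (s≤s k≤w)
  with y , wxy , wx'y ← separate x⊈x' (suc k) z<s k≤w
  = true ∷ y , cong suc wxy , ≤-<-trans (weight-∷⋀true∷ a' x' y) (s≤s wx'y)

module _ {n} (g : Vec Bool n → Bool) (t : ℕ)
         (g-symmetric : Symmetric g) (t-min : IsMinOneWeight g t) (0<t : 0 < t) where

  f : Vec Bool n → Vec Bool n → Bool
  f x y = g (x ⋀ y)

  g-light : ∀ z → weight z < t → g z ≡ false
  g-light z w<t with g z in gz≡
  ... | false = refl
  ... | true  = contradiction (proj₂ t-min z gz≡) (<⇒≱ w<t)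

  g-weight-t : ∀ z → weight z ≡ t → g z ≡ true
  g-weight-t z w≡t with z₀ , gz₀ , w₀≡t ← proj₁ t-min =
    trans (g-symmetric z z₀ (trans w≡t (sym w₀≡t))) gz₀

  lightRow : ∀ x y → weight x < t → f x y ≡ false
  lightRow x y w<t = g-light (x ⋀ y) (≤-<-trans (weight-⋀-≤ˡ x y) w<t)

  heavy≢light : ∀ x x' → t ≤ weight x → weight x' < t → ¬ SameRow f x x'
  heavy≢light x x' t≤w w'<t with y , _ , wxy ← subOfWeight x t t≤w =
    separatingColumn {f = f} (g-weight-t (x ⋀ y) wxy) (lightRow x' y w'<t)

  heavy-⊈ : ∀ {x x'} → x ⊈ x' → t ≤ weight x → ¬ SameRow f x x'
  heavy-⊈ {x} {x'} x⊈x' t≤w with y , wxy , wx'y ← separate x⊈x' t 0<t t≤w =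
    separatingColumn {f = f} (g-weight-t (x ⋀ y) wxy) (g-light (x' ⋀ y) wx'y)

  heavyRows-injective : ∀ x x' → t ≤ weight x → t ≤ weight x' → SameRow f x x' → x ≡ x'
  heavyRows-injective x x' t≤w t≤w' same with ≡⊎⊈⊎⊉ x x'
  ... | inj₁ x≡x'         = x≡x'
  ... | inj₂ (inj₁ x⊈x') = contradiction same (heavy-⊈ x⊈x' t≤w)
  ... | inj₂ (inj₂ x'⊈x) = contradiction (λ y → sym (same y)) (heavy-⊈ x'⊈x t≤w')

  rowClasses : RowClasses f (suc (#weight≥ n t))
  rowClasses = record
    { class         = class
    ; rep           = rep
    ; rep-class     = rep-class
    ; rep-injective = rep-injective
    }
    where
    zeros : Vec Bool n
    zeros = Vec.replicate n false

    weight-zeros : ∀ m → weight (Vec.replicate m false) ≡ 0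
    weight-zeros zero    = refl
    weight-zeros (suc m) = weight-zeros m

    zeros-light : weight zeros < t
    zeros-light = subst (_< t) (sym (weight-zeros n)) 0<t

    class : Vec Bool n → Fin (suc (#weight≥ n t))
    class x with t ≤? weight x
    ... | yes t≤w = suc (indexWeight≥ n t x t≤w)
    ... | no  _   = zero

    rep : Fin (suc (#weight≥ n t)) → Vec Bool n
    rep zero    = zeros
    rep (suc i) = enumWeight≥ n t i

    rep-class : ∀ x → SameRow f (rep (class x)) x
    rep-class x y with t ≤? weight x
    ... | yes t≤w = cong (λ v → f v y) (enum-index n t x t≤w)
    ... | no  t≰w = trans (lightRow zeros y zeros-light) (sym (lightRow x y (≰⇒> t≰w)))

    rep-injective : ∀ i j → SameRow f (rep i) (rep j) → i ≡ j
    rep-injective zero    zero    _    = refl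
    rep-injective zero    (suc j) same =
      contradiction (λ y → sym (same y)) (heavy≢light _ zeros (enumWeight≥-weight n t j) zeros-light)
    rep-injective (suc i) zero    same =
      contradiction same (heavy≢light _ zeros (enumWeight≥-weight n t i) zeros-light)
    rep-injective (suc i) (suc j) same = cong suc (enumWeight≥-injective n t
      (heavyRows-injective _ _ (enumWeight≥-weight n t i) (enumWeight≥-weight n t j) same))

lemma3 : (n : ℕ) (g : Vec Bool n → Bool) (t : ℕ) →
    Symmetric g → IsMinOneWeight g t → 0 < t →
    D1round≡ (λ (x y : Vec Bool n) → g (x ⋀ y)) (⌈log₂ (binomTail n t + 1) ⌉ + 1)
lemma3 n g t g-symmetric t-min 0<t =
  subst (λ R → D1round≡ (λ (x y : Vec Bool n) → g (x ⋀ y)) (⌈log₂ R ⌉ + 1)) #rows≡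
    (D1round≡-rowClasses (rowClasses g t g-symmetric t-min 0<t) (Vec.replicate n false))
  where
  #rows≡ : suc (#weight≥ n t) ≡ binomTail n t + 1
  #rows≡ = trans (+-comm 1 (#weight≥ n t)) (cong (_+ 1) (sym (binomTail≡#weight≥ n t)))
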